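{- Let $k\geq 2$ and let $P$ be a partition of $\{0,1,\dots,n\}$ with no black $k$-crossing, and suppose some red node lies under a black $(k-1)$-crossing. Let $a$ be the smallest red node lying under a black $(k-1)$-crossing, and let $(i_1,j_1),\dots,(i_{k-1},j_{k-1})$ (with $i_1<\cdots<i_{k-1}<a<j_1<\cdots<j_{k-1}$) be the black $(k-1)$-crossing under which $a$ lies whose word $(j_1,\dots,j_{k-1})$ is lexicographically smallest. Let $\tilde P$ be the partition obtained by the enhanced left shift: its red block is $\mathrm{red}(P)\setminus\{a\}$, and its other blocks are the connected components of the graph on the black elements of $P$ together with $a$ whose edges are the black arcs of $P$ with $(i_1,j_1),\dots,(i_{k-1},j_{k-1})$ removed and the arcs $(i_1,a),(i_2,j_1),\dots,(i_{k-1},j_{k-2}),(a,j_{k-1})$ added. Then $\tilde P$ has no black $k$-crossing.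
   Context: The arc diagram of a partition has an arc $(i,j)$, $i<j$, whenever $i,j$ lie in the same block and that block contains no $l$ with $i<l<j$. A $k$-crossing is a set of $k$ arcs $(i_1,j_1),\dots,(i_k,j_k)$ with $i_1<\cdots<i_k<j_1<\cdots<j_k$. The block containing $0$ is the red block $\mathrm{red}(P)$; its elements (red nodes) and arcs joining two of its elements are red, all other elements and arcs are black. A black $k$-crossing is a $k$-crossing all of whose arcs are black. A node $a$ lies under the $(k-1)$-crossing $(i_1,j_1),\dots,(i_{k-1},j_{k-1})$ if $i_{k-1}<a<j_1$. -}

module Defs where

open import Data.Nat using (ℕ; zero; suc; _<_; _≤_)
open import Data.Fin using (Fin; zero; suc; fromℕ; inject₁) renaming (_<_ to _<ᶠ_)
open import Data.Product using (_×_; ∃; ∃₂; _,_)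
open import Data.Sum using (_⊎_)
open import Relation.Binary.PropositionalEquality using (_≡_; _≢_)
open import Relation.Nullary using (¬_)
open import Relation.Binary.Construct.Closure.ReflexiveTransitive using (Star)
open import Relation.Binary.Construct.Closure.Symmetric using (SymClosure)
open import Function.Bundles using (_⇔_)

-- A partition of {0,…,n} is encoded by a block-labelling ℕ → ℕ:
-- x, y ≤ n lie in the same block iff their labels agree (values above n are ignored).
Partition : Set
Partition = ℕ → ℕ

Red : ℕ → Partition → ℕ → Set
Red n P x = x ≤ n × P x ≡ P 0

Arc : ℕ → Partition → ℕ → ℕ → Set
Arc n P i j = i < j × j ≤ n × P i ≡ P j × (∀ l → i < l → l < j → P l ≢ P i)

BlackArc : ℕ → Partition → ℕ → ℕ → Set
BlackArc n P i j = Arc n P i j × ¬ (Red n P i × Red n P j)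

Crossing : (m : ℕ) → (Fin m → ℕ) → (Fin m → ℕ) → Set
Crossing m is js =
  (∀ r s → r <ᶠ s → is r < is s) × (∀ r s → r <ᶠ s → js r < js s) × (∀ r s → is r < js s)

BlackCrossing : ℕ → Partition → (m : ℕ) → (Fin m → ℕ) → (Fin m → ℕ) → Set
BlackCrossing n P m is js = Crossing m is js × (∀ r → BlackArc n P (is r) (js r))

NoBlackCrossing : ℕ → Partition → ℕ → Set
NoBlackCrossing n P m = ∀ is js → ¬ BlackCrossing n P m is js

Under : (m : ℕ) → (Fin m → ℕ) → (Fin m → ℕ) → ℕ → Set
Under m is js a = ∀ r s → is r < a × a < js s

RedUnder : ℕ → Partition → ℕ → ℕ → Set
RedUnder n P m a =
  Red n P a × ∃₂ λ is js → BlackCrossing n P m is js × Under m is js a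

LexLt : (m : ℕ) → (Fin m → ℕ) → (Fin m → ℕ) → Set
LexLt m u v = ∃ λ r → u r < v r × (∀ s → s <ᶠ r → u s ≡ v s)

-- Edges of the graph for the enhanced left shift, for a black (m+1)-crossing
-- (is, js) (k = m+2) and node a.
NewArc : (m : ℕ) → (Fin (suc m) → ℕ) → (Fin (suc m) → ℕ) → ℕ → ℕ → ℕ → Set
NewArc m is js a x y =
  (x ≡ is zero × y ≡ a)
  ⊎ (∃ λ (r : Fin m) → x ≡ is (suc r) × y ≡ js (inject₁ r))
  ⊎ (x ≡ a × y ≡ js (fromℕ m))

ShiftEdge : ℕ → Partition → (m : ℕ) → (Fin (suc m) → ℕ) → (Fin (suc m) → ℕ) → ℕ → ℕ → ℕ → Set
ShiftEdge n P m is js a x y =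
  (BlackArc n P x y × ¬ (∃ λ r → x ≡ is r × y ≡ js r)) ⊎ NewArc m is js a x y

ShiftConn : ℕ → Partition → (m : ℕ) → (Fin (suc m) → ℕ) → (Fin (suc m) → ℕ) → ℕ → ℕ → ℕ → Set
ShiftConn n P m is js a = Star (SymClosure (ShiftEdge n P m is js a))

IsEnhancedLeftShift : ℕ → Partition → (m : ℕ) → (Fin (suc m) → ℕ) → (Fin (suc m) → ℕ) → ℕ → Partition → Set
IsEnhancedLeftShift n P m is js a Q =
  (∀ x → x ≤ n → (Q x ≡ Q 0 ⇔ (Red n P x × x ≢ a)))
  × (∀ x y → x ≤ n → y ≤ n → (¬ Red n P x ⊎ x ≡ a) → (¬ Red n P y ⊎ y ≡ a)
       → (Q x ≡ Q y ⇔ ShiftConn n P m is js a x y))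

module Submission where

open import Defs
open import Data.Nat using (ℕ; suc; _<_)
open import Data.Fin using (Fin)
open import Relation.Nullary using (¬_)

open import Data.Nat using (zero; pred; _+_; _∸_; _≤_; _>_; _<?_; z≤n; s≤s)
open import Data.Nat.Properties as ℕₚ using ()
open import Data.Fin using (zero; suc; toℕ; fromℕ; inject₁) renaming (_<_ to _<ᶠ_)
open import Data.Fin.Properties as Finₚ using ()
open import Data.Product using (_×_; _,_; proj₁; proj₂; ∃₂; swap)
open import Data.Sum using (_⊎_; inj₁; inj₂)
open import Data.Empty using (⊥; ⊥-elim)
open import Data.List using (List; []; _∷_; _++_; _∷ʳ_; length; applyUpTo; reverse; [_]; map; tabulate)
open import Data.List.Properties
  using (length-++; length-tabulate; length-applyUpTo; ++-assoc; length-map; length-reverse; reverse-++; unfold-reverse; map-++)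
open import Data.List.Relation.Unary.All as All using (All; []; _∷_)
open import Data.List.Relation.Unary.All.Properties as Allₚ using ()
open import Data.List.Relation.Unary.AllPairs as AllPairs using (AllPairs; []; _∷_)
open import Data.List.Relation.Unary.AllPairs.Properties as AllPairsₚ using ()
open import Relation.Binary.PropositionalEquality hiding ([_]; J)
open import Relation.Binary.Definitions using (Tri; tri<; tri≈; tri>)
open import Relation.Binary.Construct.Closure.ReflexiveTransitive using (Star; ε; _◅_; _◅◅_)
open import Relation.Binary.Construct.Closure.Symmetric using (SymClosure; fwd; bwd)
open import Relation.Nullary using (yes; no)
open import Function using (flip; _∘_)
open import Function.Bundles using (Equivalence)

-- Write K = k-1 and c t = (I t , J t), t < K, for the lexicographically least
-- black K-crossing over the red node a.  The black arcs of the shift Q are the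
-- shift arcs: the black arcs of P other than the c t, and the new arcs
-- (I 0 , a), (I (t+1) , J t) and (a , J (K-1)).
--  1. c is pointwise extremal: in every black K-crossing over a, the t-th arc
--     ends at or after J t (J-minimal, from lexicographic minimality and the
--     absence of black (K+1)-crossings) and starts at or before I t (I-maximal).
--  2. Exchange argument, for an arbitrary strict total order: scanning a
--     (K+1)-crossing of shift arcs left of a, new arcs are replaced by c's and
--     the old arcs they obstruct by later c's; this yields a black
--     (K+1)-crossing of P unless J-minimal fails.
--  3. A crossing of shift arcs lies left of a or right of a; the right case is
--     the left case for the mirror image, where I-maximal replaces J-minimal.
--  4. The shift graph is a union of increasing paths, so the black arcs of Q
--     are shift arcs, and lemma3p2 follows from 2 and 3.

run : {A : Set} → (ℕ → A) → ℕ → ℕ → List A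
run c lo d = applyUpTo (λ i → c (lo + i)) d

module _ {A : Set} where

  run-all : ∀ {P : A → Set} c lo d → (∀ {v} → lo ≤ v → v < lo + d → P (c v)) → All P (run c lo d)
  run-all c lo d h = Allₚ.applyUpTo⁺₁ _ d (λ {i} i<d → h (ℕₚ.m≤m+n lo i) (ℕₚ.+-monoʳ-< lo i<d))

  run-pairs : ∀ {R : A → A → Set} c lo d → (∀ {w v} → w < v → v < lo + d → R (c w) (c v)) → AllPairs R (run c lo d)
  run-pairs c lo d h = AllPairsₚ.applyUpTo⁺₁ _ d (λ {i} i<j j<d → h (ℕₚ.+-monoʳ-< lo i<j) (ℕₚ.+-monoʳ-< lo j<d))

  length-∷ʳ : ∀ (xs : List A) x → length (xs ∷ʳ x) ≡ suc (length xs)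
  length-∷ʳ xs x = trans (length-++ xs) (ℕₚ.+-comm (length xs) 1)

  AllPairs-∷ʳ : ∀ {R : A → A → Set} {xs x} → AllPairs R xs → All (λ y → R y x) xs → AllPairs R (xs ∷ʳ x)
  AllPairs-∷ʳ rxs rx = AllPairsₚ.++⁺ rxs ([] ∷ []) (All.map (_∷ []) rx)

  AllPairs-++⁻ : ∀ {R : A → A → Set} xs {ys} → AllPairs R (xs ++ ys)
    → AllPairs R xs × AllPairs R ys × All (λ x → All (R x) ys) xs
  AllPairs-++⁻ [] rys = [] , rys , []
  AllPairs-++⁻ (x ∷ xs) (rx ∷ rxs) with AllPairs-++⁻ xs rxs | Allₚ.++⁻ xs rx
  ... | pxs , pys , cross | rx-xs , rx-ys = (rx-xs ∷ pxs) , pys , (rx-ys ∷ cross)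

  All-reverse : ∀ {P : A → Set} {xs} → All P xs → All P (reverse xs)
  All-reverse [] = []
  All-reverse {P} {x ∷ xs} (px ∷ pxs) =
    subst (All P) (sym (unfold-reverse x xs)) (Allₚ.++⁺ (All-reverse pxs) (px ∷ []))

  AllPairs-reverse : ∀ {R : A → A → Set} {xs} → AllPairs R xs → AllPairs (flip R) (reverse xs)
  AllPairs-reverse [] = []
  AllPairs-reverse {R} {x ∷ xs} (rx ∷ rxs) =
    subst (AllPairs (flip R)) (sym (unfold-reverse x xs)) (AllPairs-∷ʳ (AllPairs-reverse rxs) (All-reverse rx))

  unsnoc : ∀ (W : List A) {p} → length W ≡ suc p → ∃₂ λ V w → W ≡ V ∷ʳ w × length V ≡ p
  unsnoc (x ∷ []) {zero} refl = [] , x , refl , refl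
  unsnoc (x ∷ y ∷ W) {suc p} eq with unsnoc (y ∷ W) (ℕₚ.suc-injective eq)
  ... | V , w , yW≡Vw , len = x ∷ V , w , cong (x ∷_) yW≡Vw , cong suc len

-- Arcs over an arbitrary strict total order; it is instantiated with ℕ and
-- with ℕ in reverse order.
module OrderedArcs {A : Set} (_≺_ : A → A → Set)
  (≺-trans : ∀ {p q r} → p ≺ q → q ≺ r → p ≺ r)
  (compare : ∀ p q → Tri (p ≺ q) (p ≡ q) (q ≺ p)) where

  ≺-irrefl : ∀ {p} → ¬ (p ≺ p)
  ≺-irrefl {p} p≺p with compare p p
  ... | tri< _ p≢p _ = p≢p refl
  ... | tri≈ _ _ p⊀p = p⊀p p≺p
  ... | tri> p⊀p _ _ = p⊀p p≺p

  _≼_ : A → A → Set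
  p ≼ q = p ≺ q ⊎ p ≡ q

  ≼-≺-trans : ∀ {p q r} → p ≼ q → q ≺ r → p ≺ r
  ≼-≺-trans (inj₁ p≺q) q≺r = ≺-trans p≺q q≺r
  ≼-≺-trans (inj₂ refl) q≺r = q≺r

  ≺-≼-trans : ∀ {p q r} → p ≺ q → q ≼ r → p ≺ r
  ≺-≼-trans p≺q (inj₁ q≺r) = ≺-trans p≺q q≺r
  ≺-≼-trans p≺q (inj₂ refl) = p≺q

  Chord : Set
  Chord = A × A

  X Y : Chord → A
  X = proj₁
  Y = proj₂

  -- e crosses f from the left: X e ≺ X f ≺ Y e ≺ Y f.  A crossing is a list
  -- of arcs crossing pairwise from left to right.
  Crosses : Chord → Chord → Set
  Crosses e f = X e ≺ X f × Y e ≺ Y f × X f ≺ Y e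

  Covers : A → Chord → Set
  Covers a e = X e ≺ a × a ≺ Y e

  module OverPoint (K : ℕ) (I J : ℕ → A) (a : A)
    (I-mono : ∀ {t u} → t < u → u < K → I t ≺ I u)
    (J-mono : ∀ {t u} → t < u → u < K → J t ≺ J u)
    (I≺a : ∀ {t} → t < K → I t ≺ a)
    (a≺J : ∀ {t} → t < K → a ≺ J t) where

    c : ℕ → Chord
    c t = I t , J t

    I-mono≤ : ∀ {t u} → t ≤ u → u < K → I t ≼ I u
    I-mono≤ t≤u u<K with ℕₚ.m≤n⇒m<n∨m≡n t≤u
    ... | inj₁ t<u = inj₁ (I-mono t<u u<K)
    ... | inj₂ refl = inj₂ refl

    J-mono≤ : ∀ {t u} → t ≤ u → u < K → J t ≼ J u
    J-mono≤ t≤u u<K with ℕₚ.m≤n⇒m<n∨m≡n t≤u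
    ... | inj₁ t<u = inj₁ (J-mono t<u u<K)
    ... | inj₂ refl = inj₂ refl

    I-reflects : ∀ {t u} → t < K → u < K → I t ≺ I u → t < u
    I-reflects {t} {u} t<K u<K It≺Iu with ℕₚ.<-cmp t u
    ... | tri< t<u _ _ = t<u
    ... | tri≈ _ refl _ = ⊥-elim (≺-irrefl It≺Iu)
    ... | tri> _ _ u<t = ⊥-elim (≺-irrefl (≺-trans It≺Iu (I-mono u<t t<K)))

    covers-c : ∀ {t} → t < K → Covers a (c t)
    covers-c t<K = I≺a t<K , a≺J t<K

    c-crossing : ∀ {w v} → w < v → v < K → Crosses (c w) (c v)
    c-crossing w<v v<K = I-mono w<v v<K , J-mono w<v v<K , ≺-trans (I≺a v<K) (a≺J (ℕₚ.<-trans w<v v<K))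

    run-crossing : ∀ lo d → lo + d ≤ K → AllPairs Crosses (run c lo d)
    run-crossing lo d ≤K = run-pairs c lo d (λ w<v v<lo+d → c-crossing w<v (ℕₚ.<-≤-trans v<lo+d ≤K))

    crosses-c : ∀ {g v} → v < K → X g ≺ I v → Y g ≺ J v → a ≺ Y g → Crosses g (c v)
    crosses-c v<K Xg≺Iv Yg≺Jv a≺Yg = Xg≺Iv , Yg≺Jv , ≺-trans (I≺a v<K) a≺Yg

    c-crosses : ∀ {w g} → w < K → I w ≺ X g → J w ≺ Y g → X g ≺ a → Crosses (c w) g
    c-crosses w<K Iw≺Xg Jw≺Yg Xg≺a = Iw≺Xg , Jw≺Yg , ≺-trans Xg≺a (a≺J w<K)

    -- The enhanced left shift replaces c 0, …, c (K-1) by the arcs (I t , R t)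
    -- (and (a , J (K-1)), which is treated separately).
    R : ℕ → A
    R zero = a
    R (suc t) = J t

    R≺J : ∀ {t} → t < K → R t ≺ J t
    R≺J {zero} t<K = a≺J t<K
    R≺J {suc t} t<K = J-mono (ℕₚ.n<1+n t) t<K

    a≼R : ∀ {t} → t < K → a ≼ R t
    a≼R {zero} _ = inj₂ refl
    a≼R {suc t} t<K = inj₁ (a≺J (ℕₚ.<-trans (ℕₚ.n<1+n t) t<K))

    J≼R : ∀ {w t} → w < t → t < K → J w ≼ R t
    J≼R {w} {suc t} (s≤s w≤t) t<K = J-mono≤ w≤t (ℕₚ.<-trans (ℕₚ.n<1+n t) t<K)

    -- Exchange argument: if the black arcs B have no (K+1)-crossing and c has
    -- pointwise minimal right ends among the black K-crossings over a, then
    -- the shifted arcs starting left of a have no (K+1)-crossing either.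
    module Exchange (B : Chord → Set)
      (c-black : ∀ {t} → t < K → B (c t))
      (no-long-crossing : ∀ L → AllPairs Crosses L → All B L → length L ≡ suc K → ⊥)
      (J-minimal : ∀ W z S → AllPairs Crosses (W ++ z ∷ S) × All B (W ++ z ∷ S) × All (Covers a) (W ++ z ∷ S)
         → length (W ++ z ∷ S) ≡ K → Y z ≺ J (length W) → ⊥)
      (left-unique : ∀ {e f} → B e → B f → X e ≡ X f → e ≡ f)
      (right-unique : ∀ {e f} → B e → B f → Y e ≡ Y f → e ≡ f)
      where

      CrossingOver : List Chord → Set
      CrossingOver L = AllPairs Crosses L × All B L × All (Covers a) L

      data Shifted : Chord → Set where
        old : ∀ {e} → B e → (∀ {t} → t < K → e ≢ c t) → Shifted e
        new : ∀ {t} → t < K → Shifted (I t , R t)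

      next : ∀ {p} (rest : List Chord) → p + suc (length rest) ≡ suc K → suc p + length rest ≡ suc K
      next {p} rest eq = trans (sym (ℕₚ.+-suc p (length rest))) eq

      -- A given crossing with first right end H is scanned from left to right,
      -- while a black crossing of the same length is assembled: old arcs are
      -- kept, and each new arc (I t , R t) is replaced by c t.  Since R t ≺ J t,
      -- a later old arc may fail to cross c t; it is then skipped and the next
      -- c (t+1), c (t+2), … is used instead (see Deferred).
      module Scan (H : A) where

        record Assembled (p : ℕ) (g : Chord) : Set where
          field
            arcs : List Chord
            size : length arcs ≡ p
            crossing : AllPairs Crosses arcs
            black : All B arcs
            bounded : All (λ z → X z ≼ X g × Y z ≼ Y g × H ≼ Y z) arcs
            reaches : H ≼ Y g

        start : ∀ w → B w → H ≼ Y w → Assembled 1 w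
        start w bw H≼Yw = record
          { arcs = [ w ] ; size = refl ; crossing = [] ∷ [] ; black = bw ∷ []
          ; bounded = (inj₂ refl , inj₂ refl , H≼Yw) ∷ [] ; reaches = H≼Yw }

        extend : ∀ {p g} → Assembled p g → ∀ w → B w → X g ≺ X w → Y g ≺ Y w → X w ≺ H → Assembled (suc p) w
        extend {g = g} acc w bw Xg≺Xw Yg≺Yw Xw≺H = record
          { arcs = arcs ∷ʳ w
          ; size = trans (length-∷ʳ arcs w) (cong suc size)
          ; crossing = AllPairs-∷ʳ crossing (All.map crosses-w bounded)
          ; black = Allₚ.++⁺ black (bw ∷ [])
          ; bounded = Allₚ.++⁺ (All.map below-w bounded) ((inj₂ refl , inj₂ refl , H≼Yw) ∷ [])
          ; reaches = H≼Yw }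
          where
          open Assembled acc
          H≼Yw : H ≼ Y w
          H≼Yw = inj₁ (≼-≺-trans reaches Yg≺Yw)
          crosses-w : ∀ {z} → X z ≼ X g × Y z ≼ Y g × H ≼ Y z → Crosses z w
          crosses-w (Xz≼Xg , Yz≼Yg , H≼Yz) = ≼-≺-trans Xz≼Xg Xg≺Xw , ≼-≺-trans Yz≼Yg Yg≺Yw , ≺-≼-trans Xw≺H H≼Yz
          below-w : ∀ {z} → X z ≼ X g × Y z ≼ Y g × H ≼ Y z → X z ≼ X w × Y z ≼ Y w × H ≼ Y z
          below-w (Xz≼Xg , Yz≼Yg , H≼Yz) = inj₁ (≼-≺-trans Xz≼Xg Xg≺Xw) , inj₁ (≼-≺-trans Yz≼Yg Yg≺Yw) , H≼Yz

        complete : ∀ {p g} → Assembled p g → p + 0 ≡ suc K → ⊥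
        complete {p} acc eq = no-long-crossing arcs crossing black (trans size (trans (sym (ℕₚ.+-identityʳ p)) eq))
          where open Assembled acc

        Remaining : Chord → Set
        Remaining f = Shifted f × X f ≺ a × X f ≺ H

        Over : ℕ → Chord → Set
        Over t f = I t ≺ X f × R t ≺ Y f

        from-left : ∀ {e f} → Crosses e f → X e ≺ X f × Y e ≺ Y f
        from-left (Xe≺Xf , Ye≺Yf , _) = Xe≺Xf , Ye≺Yf

        Trapped : ℕ → Chord → Set
        Trapped t g = B g × Over t g × X g ≺ a

        trapped-covers : ∀ {t g} → t < K → Trapped t g → Covers a g
        trapped-covers t<K (_ , (_ , Rt≺Yg) , Xg≺a) = Xg≺a , ≼-≺-trans (a≼R t<K) Rt≺Yg

        -- old arcs skipped since the new arc (I t , R t) was replaced; the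
        -- assembled crossing meanwhile used c t, …, c u
        record Deferred (t u : ℕ) (rest : List Chord) : Set where
          field
            skipped : List Chord
            count : u ≡ t + length skipped
            skipped-crossing : AllPairs Crosses skipped
            skipped-trapped : All (Trapped t) skipped
            skipped-cross-rest : All (λ g → All (Crosses g) rest) skipped

        nothing-deferred : ∀ {t rest} → Deferred t t rest
        nothing-deferred {t} = record
          { skipped = [] ; count = sym (ℕₚ.+-identityʳ t) ; skipped-crossing = []
          ; skipped-trapped = [] ; skipped-cross-rest = [] }

        defer : ∀ {t u f rest} → Deferred t u (f ∷ rest) → Trapped t f → All (Crosses f) rest → Deferred t (suc u) rest
        defer {t} {f = f} d tf f-rest = record
          { skipped = skipped ∷ʳ f
          ; count = trans (cong suc count)
                      (trans (sym (ℕₚ.+-suc t (length skipped))) (cong (t +_) (sym (length-∷ʳ skipped f))))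
          ; skipped-crossing = AllPairs-∷ʳ skipped-crossing (All.map All.head skipped-cross-rest)
          ; skipped-trapped = Allₚ.++⁺ skipped-trapped (tf ∷ [])
          ; skipped-cross-rest = Allₚ.++⁺ (All.map All.tail skipped-cross-rest) (f-rest ∷ []) }
          where open Deferred d

        blocking : ∀ {t u rest} → Deferred t u rest → Chord → List Chord
        blocking {t} {u} d f = run c 0 t ++ Deferred.skipped d ++ f ∷ run c (suc u) (K ∸ suc u)

        length-blocking : ∀ {t u f rest} → u < K → (d : Deferred t u (f ∷ rest)) → length (blocking d f) ≡ K
        length-blocking {t} {u} {f} u<K d = begin
          length (run c 0 t ++ skipped ++ f ∷ S)           ≡⟨ length-++ (run c 0 t) ⟩
          length (run c 0 t) + length (skipped ++ f ∷ S)   ≡⟨ cong₂ _+_ (length-applyUpTo _ t) (length-++ skipped) ⟩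
          t + (length skipped + suc (length S))            ≡⟨ cong (λ s → t + (length skipped + suc s)) (length-applyUpTo _ (K ∸ suc u)) ⟩
          t + (length skipped + suc (K ∸ suc u))           ≡⟨ sym (ℕₚ.+-assoc t (length skipped) _) ⟩
          (t + length skipped) + suc (K ∸ suc u)           ≡⟨ cong (_+ suc (K ∸ suc u)) (sym count) ⟩
          u + suc (K ∸ suc u)                              ≡⟨ ℕₚ.+-suc u (K ∸ suc u) ⟩
          suc u + (K ∸ suc u)                              ≡⟨ ℕₚ.m+[n∸m]≡n u<K ⟩
          K                                                ∎
          where
          open Deferred d
          open ≡-Reasoning
          S = run c (suc u) (K ∸ suc u)

        blocking-crossing : ∀ {t u f rest} → u < K → (d : Deferred t u (f ∷ rest)) → Trapped t f → Y f ≺ J u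
          → (∀ {v} → u < v → v < K → X f ≺ I v) → CrossingOver (blocking d f)
        blocking-crossing {t} {u} {f} {rest} u<K d tf Yf≺Ju Xf≺I =
          AllPairsₚ.++⁺ (run-crossing 0 t (ℕₚ.<⇒≤ t<K))
            (AllPairsₚ.++⁺ skipped-crossing
              (crosses-S (inj₂ refl) (inj₂ refl) (proj₂ (trapped-covers t<K tf)) ∷ run-crossing (suc u) _ (ℕₚ.≤-reflexive S-ends))
              (All.zipWith (λ (g-rest , tg) → skipped-cross-tail g-rest tg) (skipped-cross-rest , skipped-trapped)))
            (run-all c 0 t λ _ w<t → prefix-crosses w<t)
          , Allₚ.++⁺ (run-all c 0 t λ _ w<t → c-black (ℕₚ.<-trans w<t t<K))
              (Allₚ.++⁺ (All.map proj₁ skipped-trapped) (proj₁ tf ∷ run-all c (suc u) _ λ _ v<end → c-black (in-S v<end)))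
          , Allₚ.++⁺ (run-all c 0 t λ _ w<t → covers-c (ℕₚ.<-trans w<t t<K))
              (Allₚ.++⁺ (All.map (trapped-covers t<K) skipped-trapped)
                (trapped-covers t<K tf ∷ run-all c (suc u) _ λ _ v<end → covers-c (in-S v<end)))
          where
          open Deferred d
          t≤u : t ≤ u
          t≤u = subst (t ≤_) (sym count) (ℕₚ.m≤m+n t (length skipped))
          t<K : t < K
          t<K = ℕₚ.≤-<-trans t≤u u<K
          S-ends : suc u + (K ∸ suc u) ≡ K
          S-ends = ℕₚ.m+[n∸m]≡n u<K
          in-S : ∀ {v} → v < suc u + (K ∸ suc u) → v < K
          in-S v<end = ℕₚ.<-≤-trans v<end (ℕₚ.≤-reflexive S-ends)
          crosses-S : ∀ {g} → X g ≼ X f → Y g ≼ Y f → a ≺ Y g → All (Crosses g) (run c (suc u) (K ∸ suc u))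
          crosses-S Xg≼Xf Yg≼Yf a≺Yg = run-all c (suc u) _ λ u<v v<end →
            crosses-c (in-S v<end) (≼-≺-trans Xg≼Xf (Xf≺I u<v (in-S v<end)))
              (≼-≺-trans Yg≼Yf (≺-trans Yf≺Ju (J-mono u<v (in-S v<end)))) a≺Yg
          skipped-cross-tail : ∀ {g} → All (Crosses g) (f ∷ rest) → Trapped t g
            → All (Crosses g) (f ∷ run c (suc u) (K ∸ suc u))
          skipped-cross-tail (g-crosses-f@(Xg≺Xf , Yg≺Yf , _) ∷ _) tg =
            g-crosses-f ∷ crosses-S (inj₁ Xg≺Xf) (inj₁ Yg≺Yf) (proj₂ (trapped-covers t<K tg))
          c-crosses-trapped : ∀ {w g} → w < t → Trapped t g → Crosses (c w) g
          c-crosses-trapped w<t (_ , (It≺Xg , Rt≺Yg) , Xg≺a) =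
            c-crosses (ℕₚ.<-trans w<t t<K) (≺-trans (I-mono w<t t<K) It≺Xg) (≼-≺-trans (J≼R w<t t<K) Rt≺Yg) Xg≺a
          prefix-crosses : ∀ {w} → w < t → All (Crosses (c w)) (skipped ++ f ∷ run c (suc u) (K ∸ suc u))
          prefix-crosses w<t = Allₚ.++⁺ (All.map (c-crosses-trapped w<t) skipped-trapped)
            (c-crosses-trapped w<t tf ∷ run-all c (suc u) _ λ u<v v<end →
              c-crossing (ℕₚ.<-≤-trans w<t (ℕₚ.≤-trans t≤u (ℕₚ.<⇒≤ u<v))) (in-S v<end))

        blocked : ∀ {t u f rest} → u < K → Deferred t u (f ∷ rest) → Trapped t f → Y f ≺ J u
          → (∀ {v} → u < v → v < K → X f ≺ I v) → ⊥
        blocked {t} {u} {f} u<K d tf Yf≺Ju Xf≺I =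
          J-minimal (run c 0 t ++ skipped) f S (subst CrossingOver reassoc (blocking-crossing u<K d tf Yf≺Ju Xf≺I))
            (trans (cong length (sym reassoc)) (length-blocking u<K d)) (subst (λ p → Y f ≺ J p) position Yf≺Ju)
          where
          open Deferred d
          S = run c (suc u) (K ∸ suc u)
          reassoc : blocking d f ≡ (run c 0 t ++ skipped) ++ f ∷ S
          reassoc = sym (++-assoc (run c 0 t) skipped (f ∷ S))
          position : u ≡ length (run c 0 t ++ skipped)
          position = trans count (sym (trans (length-++ (run c 0 t)) (cong (_+ length skipped) (length-applyUpTo _ t))))

        mutual
          -- the assembled crossing ends with the old arc g of the scanned crossing
          following : ∀ {p g} rest → Assembled p g → p + length rest ≡ suc K
            → AllPairs Crosses rest → All Remaining rest → All (Crosses g) rest → ⊥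
          following [] acc len _ _ _ = complete acc len
          following (f ∷ rest) acc len (f-rest ∷ rest-crossing) ((sf , _ , Xf≺H) ∷ remaining)
                    ((Xg≺Xf , Yg≺Yf , _) ∷ _) with sf
          ... | old bf _ =
            following rest (extend acc f bf Xg≺Xf Yg≺Yf Xf≺H) (next rest len) rest-crossing remaining f-rest
          ... | new t<K =
            replaced rest t<K (extend acc (c _) (c-black t<K) Xg≺Xf (≺-trans Yg≺Yf (R≺J t<K)) Xf≺H)
              (next rest len) rest-crossing remaining (All.map proj₁ f-rest) (All.map from-left f-rest) nothing-deferred

          -- the assembled crossing ends with c u, standing in for the new arc
          -- (I t , R t) and the old arcs deferred after it
          replaced : ∀ {p t u} rest → u < K → Assembled p (c u) → p + length rest ≡ suc K
            → AllPairs Crosses rest → All Remaining rest → All (λ f → I u ≺ X f) rest → All (Over t) rest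
            → Deferred t u rest → ⊥
          replaced [] _ acc len _ _ _ _ _ = complete acc len
          replaced (f ∷ rest) u<K acc len (f-rest ∷ rest-crossing) ((sf , Xf≺a , Xf≺H) ∷ remaining)
                   (Iu≺Xf ∷ _) ((It≺Xf , Rt≺Yf) ∷ over-t) d with sf
          ... | new t′<K =
            replaced rest t′<K
              (extend acc (c _) (c-black t′<K) Iu≺Xf (J-mono (I-reflects u<K t′<K Iu≺Xf) t′<K) Xf≺H)
              (next rest len) rest-crossing remaining (All.map proj₁ f-rest) (All.map from-left f-rest) nothing-deferred
          ... | old bf not-c =
            replaced-old rest u<K acc len rest-crossing remaining f-rest (bf , (It≺Xf , Rt≺Yf) , Xf≺a) not-c
              Iu≺Xf Xf≺H over-t d

          -- an old arc f after c u is kept if it crosses c u; otherwise it is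
          -- deferred and c (u+1) is used, unless f does not fit before c (u+1)
          replaced-old : ∀ {p t u f} rest → u < K → Assembled p (c u) → p + suc (length rest) ≡ suc K
            → AllPairs Crosses rest → All Remaining rest → All (Crosses f) rest → Trapped t f
            → (∀ {v} → v < K → f ≢ c v) → I u ≺ X f → X f ≺ H → All (Over t) rest → Deferred t u (f ∷ rest) → ⊥
          replaced-old {u = u} {f} rest u<K acc len rest-crossing remaining f-rest tf not-c Iu≺Xf Xf≺H over-t d
            with compare (J u) (Y f)
          ... | tri< Ju≺Yf _ _ =
            following rest (extend acc f (proj₁ tf) Iu≺Xf Ju≺Yf Xf≺H) (next rest len) rest-crossing remaining f-rest
          ... | tri≈ _ Ju≡Yf _ = not-c u<K (right-unique (proj₁ tf) (c-black u<K) (sym Ju≡Yf))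
          ... | tri> _ _ Yf≺Ju with suc u <? K
          ...   | no u+1≮K = blocked u<K d tf Yf≺Ju λ u<v v<K → ⊥-elim (u+1≮K (ℕₚ.≤-<-trans u<v v<K))
          ...   | yes u+1<K with compare (I (suc u)) (X f)
          ...     | tri< Iu+1≺Xf _ _ =
            replaced rest u+1<K
              (extend acc (c (suc u)) (c-black u+1<K) (I-mono (ℕₚ.n<1+n u) u+1<K) (J-mono (ℕₚ.n<1+n u) u+1<K)
                (≺-trans Iu+1≺Xf Xf≺H))
              (next rest len) rest-crossing remaining (All.map (≺-trans Iu+1≺Xf ∘ proj₁) f-rest) over-t
              (defer d tf f-rest)
          ...     | tri≈ _ Iu+1≡Xf _ = not-c u+1<K (left-unique (proj₁ tf) (c-black u+1<K) (sym Iu+1≡Xf))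
          ...     | tri> _ _ Xf≺Iu+1 = blocked u<K d tf Yf≺Ju λ u<v v<K → ≺-≼-trans Xf≺Iu+1 (I-mono≤ u<v v<K)

        scan : ∀ {e} rest → Shifted e → H ≡ Y e → length rest ≡ K
          → AllPairs Crosses rest → All Remaining rest → All (Crosses e) rest → ⊥
        scan rest (old be _) H≡Ye len rest-crossing remaining e-rest =
          following rest (start _ be (inj₂ H≡Ye)) (cong suc len) rest-crossing remaining e-rest
        scan rest (new t<K) H≡Rt len rest-crossing remaining e-rest =
          replaced rest t<K (start (c _) (c-black t<K) (inj₁ (subst (_≺ J _) (sym H≡Rt) (R≺J t<K))))
            (cong suc len) rest-crossing remaining (All.map proj₁ e-rest) (All.map from-left e-rest) nothing-deferred

      no-shifted-crossing : ∀ D → AllPairs Crosses D → All Shifted D → All (λ e → X e ≺ a) D → length D ≡ suc K → ⊥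
      no-shifted-crossing (e ∷ rest) (e-rest ∷ rest-crossing) (se ∷ s-rest) (_ ∷ left-of-a) len =
        scan rest se refl (ℕₚ.suc-injective len) rest-crossing
          (All.zip (s-rest , All.zip (left-of-a , All.map (proj₂ ∘ proj₂) e-rest))) e-rest
        where open Scan (Y e)


module NatArcs = OrderedArcs _<_ ℕₚ.<-trans ℕₚ.<-cmp
open NatArcs using (X; Y; Crosses; Covers)

-- ℕ in reverse order, used to treat the crossings right of a by symmetry
flip-compare : ∀ p q → Tri (p > q) (p ≡ q) (q > p)
flip-compare p q with ℕₚ.<-cmp p q
... | tri< p<q p≢q p≯q = tri> p≯q p≢q p<q
... | tri≈ p≮q p≡q p≯q = tri≈ p≯q p≡q p≮q
... | tri> p≮q p≢q p>q = tri< p>q p≢q p≮q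

module MirrorArcs = OrderedArcs _>_ (λ p>q q>r → ℕₚ.<-trans q>r p>q) flip-compare

mirror : List (ℕ × ℕ) → List (ℕ × ℕ)
mirror L = map swap (reverse L)

mirror-all : ∀ {Q : ℕ × ℕ → Set} {L} → All (Q ∘ swap) L → All Q (mirror L)
mirror-all = Allₚ.map⁺ ∘ All-reverse

mirror-crossing : ∀ {L} → AllPairs MirrorArcs.Crosses L → AllPairs Crosses (mirror L)
mirror-crossing = AllPairsₚ.map⁺ ∘ AllPairs.map (λ (Xf<Xe , Yf<Ye , Ye<Xf) → Yf<Ye , Xf<Xe , Ye<Xf) ∘ AllPairs-reverse

mirror-crossing′ : ∀ {L} → AllPairs Crosses L → AllPairs MirrorArcs.Crosses (mirror L)
mirror-crossing′ = AllPairsₚ.map⁺ ∘ AllPairs.map (λ (Xe<Xf , Ye<Yf , Xf<Ye) → Ye<Yf , Xe<Xf , Xf<Ye) ∘ AllPairs-reverse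

length-mirror : ∀ L → length (mirror L) ≡ length L
length-mirror L = trans (length-map swap (reverse L)) (length-reverse L)

mirror-++ : ∀ W z S → mirror (W ++ z ∷ S) ≡ mirror S ++ swap z ∷ mirror W
mirror-++ W z S = begin
  map swap (reverse (W ++ z ∷ S))             ≡⟨ cong (map swap) (reverse-++ W (z ∷ S)) ⟩
  map swap (reverse (z ∷ S) ++ reverse W)     ≡⟨ cong (λ l → map swap (l ++ reverse W)) (unfold-reverse z S) ⟩
  map swap ((reverse S ∷ʳ z) ++ reverse W)    ≡⟨ cong (map swap) (++-assoc (reverse S) [ z ] (reverse W)) ⟩
  map swap (reverse S ++ z ∷ reverse W)       ≡⟨ map-++ swap (reverse S) (z ∷ reverse W) ⟩
  mirror S ++ swap z ∷ mirror W               ∎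
  where open ≡-Reasoning

-- the i-th element of a list of arcs (with a dummy default), used to read a
-- crossing given as a list as one indexed by Fin
at : List (ℕ × ℕ) → ℕ → ℕ × ℕ
at [] _ = 0 , 0
at (x ∷ xs) zero = x
at (x ∷ xs) (suc i) = at xs i

at-all : ∀ {P : ℕ × ℕ → Set} {L} → All P L → ∀ {i} → i < length L → P (at L i)
at-all (px ∷ _) {zero} _ = px
at-all (_ ∷ pxs) {suc i} (s≤s i<len) = at-all pxs i<len

at-pairs : ∀ {R : ℕ × ℕ → ℕ × ℕ → Set} {L} → AllPairs R L → ∀ {i j} → i < j → j < length L → R (at L i) (at L j)
at-pairs (rx ∷ _) {zero} {suc j} _ (s≤s j<len) = at-all rx j<len
at-pairs (_ ∷ rxs) {suc i} {suc j} (s≤s i<j) (s≤s j<len) = at-pairs rxs i<j j<len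

at-++ˡ : ∀ xs ys {i} → i < length xs → at (xs ++ ys) i ≡ at xs i
at-++ˡ (x ∷ xs) ys {zero} _ = refl
at-++ˡ (x ∷ xs) ys {suc i} (s≤s i<len) = at-++ˡ xs ys i<len

at-++-length : ∀ xs z ys → at (xs ++ z ∷ ys) (length xs) ≡ z
at-++-length [] z ys = refl
at-++-length (x ∷ xs) z ys = at-++-length xs z ys

at-run : ∀ (c : ℕ → ℕ × ℕ) d {s} → s < d → at (run c 0 d) s ≡ c s
at-run c (suc d) {zero} _ = refl
at-run c (suc d) {suc s} (s≤s s<d) = at-run (c ∘ suc) d s<d

clamp : (m : ℕ) → ℕ → Fin (suc m)
clamp m zero = zero
clamp zero (suc t) = zero
clamp (suc m) (suc t) = suc (clamp m t)

toℕ-clamp : ∀ m t → t ≤ m → toℕ (clamp m t) ≡ t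
toℕ-clamp m zero _ = refl
toℕ-clamp (suc m) (suc t) (s≤s t≤m) = cong suc (toℕ-clamp m t t≤m)

clamp-toℕ : ∀ m (r : Fin (suc m)) → clamp m (toℕ r) ≡ r
clamp-toℕ m zero = refl
clamp-toℕ (suc m) (suc r) = cong suc (clamp-toℕ m r)

module PartitionArcs (n : ℕ) (P : Partition) where

  arc-right-unique : ∀ {i j j′} → Arc n P i j → Arc n P i j′ → j ≡ j′
  arc-right-unique {j = j} {j′} (i<j , _ , Pi≡Pj , gap) (i<j′ , _ , Pi≡Pj′ , gap′) with ℕₚ.<-cmp j j′
  ... | tri< j<j′ _ _ = ⊥-elim (gap′ j i<j j<j′ (sym Pi≡Pj))
  ... | tri≈ _ j≡j′ _ = j≡j′
  ... | tri> _ _ j′<j = ⊥-elim (gap j′ i<j′ j′<j (sym Pi≡Pj′))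

  arc-left-unique : ∀ {i i′ j} → Arc n P i j → Arc n P i′ j → i ≡ i′
  arc-left-unique {i} {i′} (i<j , _ , Pi≡Pj , gap) (i′<j , _ , Pi′≡Pj , gap′) with ℕₚ.<-cmp i i′
  ... | tri< i<i′ _ _ = ⊥-elim (gap i′ i<i′ i′<j (trans Pi′≡Pj (sym Pi≡Pj)))
  ... | tri≈ _ i≡i′ _ = i≡i′
  ... | tri> _ _ i′<i = ⊥-elim (gap′ i i′<i i<j (trans Pi≡Pj (sym Pi′≡Pj)))

  Black : ℕ × ℕ → Set
  Black e = BlackArc n P (X e) (Y e)

  black-increasing : ∀ {e} → Black e → X e < Y e
  black-increasing ((X<Y , _) , _) = X<Y

  black-left-unique : ∀ {e f} → Black e → Black f → X e ≡ X f → e ≡ f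
  black-left-unique {x , _} (arc-e , _) (arc-f , _) refl = cong (x ,_) (arc-right-unique arc-e arc-f)

  black-right-unique : ∀ {e f} → Black e → Black f → Y e ≡ Y f → e ≡ f
  black-right-unique {_ , y} (arc-e , _) (arc-f , _) refl = cong (_, y) (arc-left-unique arc-e arc-f)

  -- both ends of a black arc are black, since an arc joins elements of one block
  black-left-not-red : ∀ {i j} → BlackArc n P i j → ¬ Red n P i
  black-left-not-red ((_ , j≤n , Pi≡Pj , _) , not-red) (i≤n , Pi≡P0) = not-red ((i≤n , Pi≡P0) , (j≤n , trans (sym Pi≡Pj) Pi≡P0))

  black-right-not-red : ∀ {i j} → BlackArc n P i j → ¬ Red n P j
  black-right-not-red ((i<j , j≤n , Pi≡Pj , _) , not-red) (_ , Pj≡P0) =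
    not-red ((ℕₚ.<⇒≤ (ℕₚ.<-≤-trans i<j j≤n) , trans Pi≡Pj Pj≡P0) , (j≤n , Pj≡P0))

  as-crossing : ∀ {k} L → AllPairs Crosses L → All Black L → length L ≡ k
    → BlackCrossing n P k (λ r → X (at L (toℕ r))) (λ r → Y (at L (toℕ r)))
  as-crossing {k} L crossing black len =
    ( (λ r s r<s → proj₁ (at-pairs crossing r<s (in-L s)))
    , (λ r s r<s → proj₁ (proj₂ (at-pairs crossing r<s (in-L s))))
    , left<right )
    , λ r → at-all black (in-L r)
    where
    in-L : ∀ (r : Fin k) → toℕ r < length L
    in-L r = subst (toℕ r <_) (sym len) (Finₚ.toℕ<n r)
    left<right : ∀ r s → X (at L (toℕ r)) < Y (at L (toℕ s))
    left<right r s with ℕₚ.<-cmp (toℕ r) (toℕ s)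
    ... | tri< r<s _ _ = ℕₚ.<-trans (proj₁ (at-pairs crossing r<s (in-L s))) (black-increasing (at-all black (in-L s)))
    ... | tri≈ _ r≡s _ = subst (λ q → X (at L (toℕ r)) < Y (at L q)) r≡s (black-increasing (at-all black (in-L r)))
    ... | tri> _ _ s<r = proj₂ (proj₂ (at-pairs crossing s<r (in-L r)))

increasing-injective : ∀ {K} {f : ℕ → ℕ} → (∀ {t u} → t < u → u < K → f t < f u)
  → ∀ {t u} → t < K → u < K → f t ≡ f u → t ≡ u
increasing-injective mono {t} {u} t<K u<K ft≡fu with ℕₚ.<-cmp t u
... | tri< t<u _ _ = ⊥-elim (ℕₚ.<-irrefl ft≡fu (mono t<u u<K))
... | tri≈ _ t≡u _ = t≡u
... | tri> _ _ u<t = ⊥-elim (ℕₚ.<-irrefl (sym ft≡fu) (mono u<t t<K))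

-- In a graph on ℕ whose edges point upwards and in which every node has at
-- most one outgoing and at most one incoming edge, the components are
-- increasing paths.
module IncreasingPaths (E : ℕ → ℕ → Set) (upwards : ∀ {x y} → E x y → x < y)
  (out-unique : ∀ {x y y′} → E x y → E x y′ → y ≡ y′)
  (in-unique : ∀ {x x′ y} → E x y → E x′ y → x ≡ x′) where

  path-≤ : ∀ {x y} → Star E x y → x ≤ y
  path-≤ ε = ℕₚ.≤-refl
  path-≤ (e ◅ p) = ℕₚ.≤-trans (ℕₚ.<⇒≤ (upwards e)) (path-≤ p)

  into-same : ∀ {x w z} → Star E x w → E z w → Star E x z ⊎ Star E z x
  into-same ε e = inj₂ (e ◅ ε)
  into-same {x} (e₁ ◅ p) e with into-same p e
  ... | inj₁ q = inj₁ (e₁ ◅ q)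
  ... | inj₂ ε = inj₁ (e₁ ◅ ε)
  ... | inj₂ (e₂ ◅ q) = inj₁ (subst (Star E x) (in-unique (subst (E x) x₁≡w e₁) e) ε)
    where
    -- z's unique successor is w, and w ≤ x₁ ≤ w along the paths
    x₁≡w = ℕₚ.≤-antisym (path-≤ p) (subst (_≤ _) (out-unique e₂ e) (path-≤ q))

  out-of-same : ∀ {x₁ x y} → E x₁ x → Star E x₁ y → Star E x y ⊎ Star E y x
  out-of-same e ε = inj₂ (e ◅ ε)
  out-of-same {y = y} e (e′ ◅ p) = inj₁ (subst (λ x → Star E x y) (out-unique e′ e) p)

  directed : ∀ {x y} → Star (SymClosure E) x y → Star E x y ⊎ Star E y x
  directed ε = inj₁ ε
  directed (fwd e ◅ p) with directed p
  ... | inj₁ q = inj₁ (e ◅ q)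
  ... | inj₂ q with into-same q e
  ...   | inj₁ q′ = inj₂ q′
  ...   | inj₂ q′ = inj₁ q′
  directed (bwd e ◅ p) with directed p
  ... | inj₁ q = out-of-same e q
  ... | inj₂ q = inj₂ (q ◅◅ (e ◅ ε))

  single-edge : ∀ {x y} → Star E x y → x < y → (∀ {z} → x < z → z < y → ¬ E x z) → E x y
  single-edge ε x<x _ = ⊥-elim (ℕₚ.<-irrefl refl x<x)
  single-edge (e ◅ ε) _ _ = e
  single-edge (e ◅ (e′ ◅ p)) _ no-stop = ⊥-elim (no-stop (upwards e) (ℕₚ.<-≤-trans (upwards e′) (path-≤ p)) e)

≼⇒≤ : ∀ {p q} → NatArcs._≼_ p q → p ≤ q
≼⇒≤ (inj₁ p<q) = ℕₚ.<⇒≤ p<q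
≼⇒≤ (inj₂ refl) = ℕₚ.≤-refl

module Setting (m n : ℕ) (P : Partition)
  (no-k-crossing : NoBlackCrossing n P (suc (suc m)))
  (a : ℕ) (a-red : Red n P a) (is js : Fin (suc m) → ℕ)
  (crossing : BlackCrossing n P (suc m) is js) (under : Under (suc m) is js a)
  (lex-least : ∀ is′ js′ → BlackCrossing n P (suc m) is′ js′ → Under (suc m) is′ js′ a → ¬ LexLt (suc m) js′ js)
  where

  open PartitionArcs n P

  K : ℕ
  K = suc m

  I J : ℕ → ℕ
  I t = is (clamp m t)
  J t = js (clamp m t)

  clamp-mono : ∀ {t u} → t < u → u < K → clamp m t <ᶠ clamp m u
  clamp-mono {t} {u} t<u (s≤s u≤m) =
    subst₂ _<_ (sym (toℕ-clamp m t (ℕₚ.<⇒≤ (ℕₚ.<-≤-trans t<u u≤m)))) (sym (toℕ-clamp m u u≤m)) t<u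

  I-mono : ∀ {t u} → t < u → u < K → I t < I u
  I-mono t<u u<K = proj₁ (proj₁ crossing) _ _ (clamp-mono t<u u<K)

  J-mono : ∀ {t u} → t < u → u < K → J t < J u
  J-mono t<u u<K = proj₁ (proj₂ (proj₁ crossing)) _ _ (clamp-mono t<u u<K)

  I<a : ∀ {t} → t < K → I t < a
  I<a {t} _ = proj₁ (under (clamp m t) (clamp m t))

  a<J : ∀ {t} → t < K → a < J t
  a<J {t} _ = proj₂ (under (clamp m t) (clamp m t))

  open NatArcs.OverPoint K I J a I-mono J-mono I<a a<J

  c-black : ∀ {t} → t < K → Black (c t)
  c-black {t} _ = proj₂ crossing (clamp m t)

  no-long-crossing : ∀ L → AllPairs Crosses L → All Black L → length L ≡ suc K → ⊥
  no-long-crossing L cr bl len = no-k-crossing _ _ (as-crossing L cr bl len)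

  CrossingOver : List (ℕ × ℕ) → Set
  CrossingOver L = AllPairs Crosses L × All Black L × All (Covers a) L

  position<K : ∀ (W : List (ℕ × ℕ)) z S → length (W ++ z ∷ S) ≡ K → length W < K
  position<K W z S len =
    subst (length W <_) (trans (sym (length-++ W)) len) (ℕₚ.m<m+n (length W) (s≤s z≤n))

  lex-prefix : ∀ t z S → t < K → CrossingOver (run c 0 t ++ z ∷ S) → length (run c 0 t ++ z ∷ S) ≡ K
    → Y z < J t → ⊥
  lex-prefix t z S t<K (cr , bl , cv) len Yz<Jt =
    lex-least _ _ (as-crossing L cr bl len) under-a (clamp m t , smaller , agrees)
    where
    L : List (ℕ × ℕ)
    L = run c 0 t ++ z ∷ S
    in-L : ∀ (r : Fin K) → toℕ r < length L
    in-L r = subst (toℕ r <_) (sym len) (Finₚ.toℕ<n r)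
    under-a : Under K (λ r → X (at L (toℕ r))) (λ r → Y (at L (toℕ r))) a
    under-a r s = proj₁ (at-all cv (in-L r)) , proj₂ (at-all cv (in-L s))
    clamp-t : toℕ (clamp m t) ≡ t
    clamp-t = toℕ-clamp m t (ℕₚ.≤-pred t<K)
    z-at-t : at L t ≡ z
    z-at-t = subst (λ q → at L q ≡ z) (length-applyUpTo _ t) (at-++-length (run c 0 t) z S)
    smaller : Y (at L (toℕ (clamp m t))) < J t
    smaller = subst (λ q → Y (at L q) < J t) (sym clamp-t) (subst (λ e → Y e < J t) (sym z-at-t) Yz<Jt)
    agrees : ∀ s → s <ᶠ clamp m t → Y (at L (toℕ s)) ≡ js s
    agrees s s<t = trans (cong Y (trans (at-++ˡ (run c 0 t) (z ∷ S) s<length) (at-run c t s<t′))) (cong js (clamp-toℕ m s))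
      where
      s<t′ : toℕ s < t
      s<t′ = subst (toℕ s <_) clamp-t s<t
      s<length : toℕ s < length (run c 0 t)
      s<length = subst (toℕ s <_) (sym (length-applyUpTo _ t)) s<t′

  c-prefix-then : ∀ q W z S → CrossingOver (W ++ z ∷ S) → (∀ {w} → w < q → I w < X z × J w < Y z) → q ≤ K
    → CrossingOver (run c 0 q ++ z ∷ S)
  c-prefix-then q W z S (cr , bl , cv) before q≤K =
    AllPairsₚ.++⁺ (run-crossing 0 q q≤K) zS-crossing (run-all c 0 q λ _ w<q → c-crosses-zS w<q)
    , Allₚ.++⁺ (run-all c 0 q λ _ w<q → c-black (ℕₚ.<-≤-trans w<q q≤K)) (Allₚ.++⁻ʳ W bl)
    , Allₚ.++⁺ (run-all c 0 q λ _ w<q → covers-c (ℕₚ.<-≤-trans w<q q≤K)) zS-covers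
    where
    zS-crossing : AllPairs Crosses (z ∷ S)
    zS-crossing = proj₁ (proj₂ (AllPairs-++⁻ W cr))
    zS-covers : All (Covers a) (z ∷ S)
    zS-covers = Allₚ.++⁻ʳ W cv
    c-crosses-zS : ∀ {w} → w < q → All (Crosses (c w)) (z ∷ S)
    c-crosses-zS w<q with before w<q
    ... | Iw<Xz , Jw<Yz =
      c-crosses w<K Iw<Xz Jw<Yz (proj₁ (All.head zS-covers))
      ∷ All.zipWith (λ ((Xz<Xs , Yz<Ys , _) , (Xs<a , _)) → c-crosses w<K (ℕₚ.<-trans Iw<Xz Xz<Xs) (ℕₚ.<-trans Jw<Yz Yz<Ys) Xs<a)
          (AllPairs.head zS-crossing , All.tail zS-covers)
      where
      w<K : _ < K
      w<K = ℕₚ.<-≤-trans w<q q≤K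

  -- a crossing over a whose arc z at position p lies left of c p extends to a (K+1)-crossing
  followed-by-c : ∀ W z S → CrossingOver (W ++ z ∷ S) → length (W ++ z ∷ S) ≡ K
    → X z < I (length W) → Y z < J (length W) → ⊥
  followed-by-c W z S (cr , bl , cv) len Xz<Ip Yz<Jp = no-long-crossing (W ++ z ∷ C′) crossing′ black′ length′
    where
    open ≡-Reasoning
    p = length W
    p<K : p < K
    p<K = position<K W z S len
    C′ : List (ℕ × ℕ)
    C′ = run c p (K ∸ p)
    ends : p + (K ∸ p) ≡ K
    ends = ℕₚ.m+[n∸m]≡n (ℕₚ.<⇒≤ p<K)
    in-C′ : ∀ {v} → v < p + (K ∸ p) → v < K
    in-C′ v<end = ℕₚ.<-≤-trans v<end (ℕₚ.≤-reflexive ends)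
    crosses-C′ : ∀ {x} → X x ≤ X z → Y x ≤ Y z → a < Y x → All (Crosses x) C′
    crosses-C′ Xx≤Xz Yx≤Yz a<Yx = run-all c p _ λ p≤v v<end →
      crosses-c (in-C′ v<end) (ℕₚ.≤-<-trans Xx≤Xz (ℕₚ.<-≤-trans Xz<Ip (≼⇒≤ (I-mono≤ p≤v (in-C′ v<end)))))
        (ℕₚ.≤-<-trans Yx≤Yz (ℕₚ.<-≤-trans Yz<Jp (≼⇒≤ (J-mono≤ p≤v (in-C′ v<end))))) a<Yx
    W-crossing = AllPairs-++⁻ W cr
    crossing′ : AllPairs Crosses (W ++ z ∷ C′)
    crossing′ = AllPairsₚ.++⁺ (proj₁ W-crossing)
      (crosses-C′ ℕₚ.≤-refl ℕₚ.≤-refl (proj₂ (All.head (Allₚ.++⁻ʳ W cv))) ∷ run-crossing p _ (ℕₚ.≤-reflexive ends))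
      (All.zipWith (λ (x-zS , (_ , a<Yx)) → All.head x-zS
                      ∷ crosses-C′ (ℕₚ.<⇒≤ (proj₁ (All.head x-zS))) (ℕₚ.<⇒≤ (proj₁ (proj₂ (All.head x-zS)))) a<Yx)
        (proj₂ (proj₂ W-crossing) , Allₚ.++⁻ˡ W cv))
    black′ : All Black (W ++ z ∷ C′)
    black′ = Allₚ.++⁺ (Allₚ.++⁻ˡ W bl) (All.head (Allₚ.++⁻ʳ W bl) ∷ run-all c p _ λ _ v<end → c-black (in-C′ v<end))
    length′ : length (W ++ z ∷ C′) ≡ suc K
    length′ = begin
      length (W ++ z ∷ C′)  ≡⟨ length-++ W ⟩
      p + suc (length C′)   ≡⟨ cong (λ l → p + suc l) (length-applyUpTo _ (K ∸ p)) ⟩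
      p + suc (K ∸ p)       ≡⟨ ℕₚ.+-suc p (K ∸ p) ⟩
      suc (p + (K ∸ p))     ≡⟨ cong suc ends ⟩
      suc K                 ∎

  I-mono-≤ : ∀ {t u} → t ≤ u → u < K → I t ≤ I u
  I-mono-≤ t≤u u<K = ≼⇒≤ (I-mono≤ t≤u u<K)

  J-mono-≤ : ∀ {t u} → t ≤ u → u < K → J t ≤ J u
  J-mono-≤ t≤u u<K = ≼⇒≤ (J-mono≤ t≤u u<K)

  -- c has pointwise least right ends: the arc at position p of any black
  -- K-crossing over a ends at or after J p.  By induction on p: an arc z ending
  -- before J p either lies left of c p (and followed-by-c applies) or right of
  -- it, and then c 0, …, c (p-1), z, … contradicts lexicographic minimality.
  mutual
    J-minimal-at : ∀ p W z S → length W ≡ p → CrossingOver (W ++ z ∷ S) → length (W ++ z ∷ S) ≡ K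
      → Y z < J p → ⊥
    J-minimal-at p W z S lenW good len Yz<Jp = by-cases (ℕₚ.<-cmp (X z) (I p))
      where
      p<K : p < K
      p<K = subst (_< K) lenW (position<K W z S len)
      by-cases : Tri (X z < I p) (X z ≡ I p) (I p < X z) → ⊥
      by-cases (tri< Xz<Ip _ _) =
        followed-by-c W z S good len (subst (λ q → X z < I q) (sym lenW) Xz<Ip) (subst (λ q → Y z < J q) (sym lenW) Yz<Jp)
      by-cases (tri≈ _ Xz≡Ip _) =
        ℕₚ.<-irrefl (cong Y (black-left-unique (All.head (Allₚ.++⁻ʳ W (proj₁ (proj₂ good)))) (c-black p<K) Xz≡Ip)) Yz<Jp
      by-cases (tri> _ _ Ip<Xz) =
        lex-prefix p z S p<K
          (c-prefix-then p W z S good (λ w<p → ℕₚ.<-trans (I-mono w<p p<K) Ip<Xz , J-before-last p W z S lenW good len w<p)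
            (ℕₚ.<⇒≤ p<K))
          (trans (length-++ (run c 0 p)) (trans (cong (_+ suc (length S)) (trans (length-applyUpTo _ p) (sym lenW)))
            (trans (sym (length-++ W)) len)))
          Yz<Jp

    J-before-last : ∀ p W z S → length W ≡ p → CrossingOver (W ++ z ∷ S) → length (W ++ z ∷ S) ≡ K
      → ∀ {w} → w < p → J w < Y z
    J-before-last (suc p) W z S lenW good len {w} (s≤s w≤p) with unsnoc W lenW
    ... | V , y , refl , lenV =
      ℕₚ.≤-<-trans (ℕₚ.≤-trans (J-mono-≤ w≤p p<K) (ℕₚ.≮⇒≥ (J-minimal-at p V y (z ∷ S) lenV good′ len′))) Yy<Yz
      where
      reassoc : (V ∷ʳ y) ++ z ∷ S ≡ V ++ y ∷ z ∷ S
      reassoc = ++-assoc V [ y ] (z ∷ S)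
      good′ : CrossingOver (V ++ y ∷ z ∷ S)
      good′ = subst CrossingOver reassoc good
      len′ : length (V ++ y ∷ z ∷ S) ≡ K
      len′ = trans (cong length (sym reassoc)) len
      p<K : p < K
      p<K = subst (_< K) lenV (position<K V y (z ∷ S) len′)
      Yy<Yz : Y y < Y z
      Yy<Yz = proj₁ (proj₂ (All.head (AllPairs.head (proj₁ (proj₂ (AllPairs-++⁻ V (proj₁ good′)))))))

  J-minimal : ∀ W z S → CrossingOver (W ++ z ∷ S) → length (W ++ z ∷ S) ≡ K → Y z < J (length W) → ⊥
  J-minimal W z S = J-minimal-at (length W) W z S refl

  -- dually, c has pointwise greatest left ends: otherwise c 0, …, c p followed
  -- by the arcs of the crossing from position p on would be a (K+1)-crossing
  I-maximal : ∀ W z S → CrossingOver (W ++ z ∷ S) → length (W ++ z ∷ S) ≡ K → I (length W) < X z → ⊥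
  I-maximal W z S good len Ip<Xz =
    no-long-crossing _ (proj₁ extended) (proj₁ (proj₂ extended))
      (trans (length-++ (run c 0 (suc p))) (cong suc (trans (cong (_+ suc (length S)) (length-applyUpTo _ p))
        (trans (sym (length-++ W)) len))))
    where
    p = length W
    p<K : p < K
    p<K = position<K W z S len
    Jp<Yz : J p < Y z
    Jp<Yz with ℕₚ.<-cmp (J p) (Y z)
    ... | tri< Jp<Yz _ _ = Jp<Yz
    ... | tri≈ _ Jp≡Yz _ =
      ⊥-elim (ℕₚ.<-irrefl (cong X (black-right-unique (c-black p<K) (All.head (Allₚ.++⁻ʳ W (proj₁ (proj₂ good)))) Jp≡Yz)) Ip<Xz)
    ... | tri> _ _ Yz<Jp = ⊥-elim (J-minimal W z S good len Yz<Jp)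
    before : ∀ {w} → w < suc p → I w < X z × J w < Y z
    before (s≤s w≤p) = ℕₚ.≤-<-trans (I-mono-≤ w≤p p<K) Ip<Xz , ℕₚ.≤-<-trans (J-mono-≤ w≤p p<K) Jp<Yz
    extended : CrossingOver (run c 0 (suc p) ++ z ∷ S)
    extended = c-prefix-then (suc p) W z S good before p<K

  -- The arcs of the shift graph: black arcs other than the c t, the arcs
  -- (I t , R t) = (i_1 , a), (i_2 , j_1), …, (i_K , j_(K-1)), and (a , j_K).
  data ShiftArc : ℕ × ℕ → Set where
    old : ∀ {e} → Black e → (∀ {t} → t < K → e ≢ c t) → ShiftArc e
    new : ∀ {t} → t < K → ShiftArc (I t , R t)
    last : ShiftArc (a , J m)

  shift-increasing : ∀ {e} → ShiftArc e → X e < Y e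
  shift-increasing (old be _) = black-increasing be
  shift-increasing (new {zero} t<K) = I<a t<K
  shift-increasing (new {suc t} t<K) = ℕₚ.<-trans (I<a t<K) (a<J (ℕₚ.<-trans (ℕₚ.n<1+n t) t<K))
  shift-increasing last = a<J (ℕₚ.n<1+n m)

  left-or-right : ∀ D → AllPairs Crosses D → All ShiftArc D → All (λ e → X e < a) D ⊎ All (λ e → a < Y e) D
  left-or-right [] _ _ = inj₁ []
  left-or-right (e ∷ D) (e-D ∷ _) (se ∷ _) with a <? Y e
  ... | yes a<Ye = inj₂ (a<Ye ∷ All.map (λ (_ , Ye<Yf , _) → ℕₚ.<-trans a<Ye Ye<Yf) e-D)
  ... | no a≮Ye = inj₁ (ℕₚ.<-≤-trans (shift-increasing se) Ye≤a ∷ All.map (λ (_ , _ , Xf<Ye) → ℕₚ.<-≤-trans Xf<Ye Ye≤a) e-D)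
    where
    Ye≤a : Y e ≤ a
    Ye≤a = ℕₚ.≮⇒≥ a≮Ye

  module Left = Exchange Black c-black no-long-crossing J-minimal
    black-left-unique black-right-unique

  left-shifted : ∀ {e} → ShiftArc e → X e < a → Left.Shifted e
  left-shifted (old be not-c) _ = Left.old be not-c
  left-shifted (new t<K) _ = Left.new t<K
  left-shifted last a<a = ⊥-elim (ℕₚ.<-irrefl refl a<a)

  -- Right of a, it applies to the mirror image, where c becomes
  -- c (K-1), …, c 0 and the roles of J-minimal and I-maximal are exchanged.
  I′ J′ : ℕ → ℕ
  I′ t = J (m ∸ t)
  J′ t = I (m ∸ t)

  m∸t<K : ∀ t → m ∸ t < K
  m∸t<K t = s≤s (ℕₚ.m∸n≤m m t)

  reverses : ∀ {t u} → t < u → u < K → m ∸ u < m ∸ t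
  reverses t<u u<K = ℕₚ.∸-monoʳ-< t<u (ℕₚ.≤-pred u<K)

  module MirrorPoint = MirrorArcs.OverPoint K I′ J′ a
    (λ {t} t<u u<K → J-mono (reverses t<u u<K) (m∸t<K t)) (λ {t} t<u u<K → I-mono (reverses t<u u<K) (m∸t<K t))
    (λ {t} _ → a<J (m∸t<K t)) (λ {t} _ → I<a (m∸t<K t))

  J′-minimal : ∀ W z S
    → AllPairs MirrorArcs.Crosses (W ++ z ∷ S) × All (Black ∘ swap) (W ++ z ∷ S) × All (MirrorArcs.Covers a) (W ++ z ∷ S)
    → length (W ++ z ∷ S) ≡ K → J′ (length W) < Y z → ⊥
  J′-minimal W z S (cr , bl , cv) len I<Xz = I-maximal (mirror S) (swap z) (mirror W)
    (subst CrossingOver (mirror-++ W z S) (mirror-crossing cr , mirror-all bl , mirror-all (All.map swap cv)))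
    (trans (cong length (sym (mirror-++ W z S))) (trans (length-mirror (W ++ z ∷ S)) len))
    (subst (λ p → I p < Y z) (sym position) I<Xz)
    where
    position : length (mirror S) ≡ m ∸ length W
    position = trans (length-mirror S) (sym (trans (cong (_∸ length W) m≡) (ℕₚ.m+n∸m≡n (length W) (length S))))
      where
      m≡ : m ≡ length W + length S
      m≡ = ℕₚ.suc-injective (trans (sym len) (trans (length-++ W) (ℕₚ.+-suc (length W) (length S))))

  module Right = MirrorPoint.Exchange (Black ∘ swap) (λ {t} _ → c-black (m∸t<K t))
    (λ L cr bl len → no-long-crossing (mirror L) (mirror-crossing cr) (mirror-all bl) (trans (length-mirror L) len))
    J′-minimal
    (λ be bf Xe≡Xf → cong swap (black-right-unique be bf Xe≡Xf))
    (λ be bf Ye≡Yf → cong swap (black-left-unique be bf Ye≡Yf))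

  right-shifted : ∀ {e} → ShiftArc e → a < Y e → Right.Shifted (swap e)
  right-shifted (old be not-c) _ = Right.old be λ {t} _ swap-e≡c′ → not-c (m∸t<K t) (cong swap swap-e≡c′)
  right-shifted (new {zero} _) a<a = ⊥-elim (ℕₚ.<-irrefl refl a<a)
  right-shifted (new {suc t} t+1<K) _ = subst Right.Shifted (cong₂ _,_ (cong J left) (cong I right)) (Right.new s+1<K)
    where
    t+1≤m : suc t ≤ m
    t+1≤m = ℕₚ.≤-pred t+1<K
    s : ℕ
    s = m ∸ suc t
    s+1<K : suc s < K
    s+1<K = s≤s (ℕₚ.∸-monoʳ-< (s≤s z≤n) t+1≤m)
    right : m ∸ s ≡ suc t
    right = ℕₚ.m∸[m∸n]≡n t+1≤m
    left : m ∸ suc s ≡ t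
    left = trans (sym (ℕₚ.pred[m∸n]≡m∸[1+n] m s)) (cong pred right)
  right-shifted last _ = Right.new (s≤s z≤n)

  no-shift-crossing : ∀ D → AllPairs Crosses D → All ShiftArc D → length D ≡ suc K → ⊥
  no-shift-crossing D cr shift len with left-or-right D cr shift
  ... | inj₁ left = Left.no-shifted-crossing D cr (All.zipWith (λ (se , Xe<a) → left-shifted se Xe<a) (shift , left)) left len
  ... | inj₂ right = Right.no-shifted-crossing (mirror D) (mirror-crossing′ cr)
    (mirror-all (All.zipWith (λ (se , a<Ye) → right-shifted se a<Ye) (shift , right))) (mirror-all right)
    (trans (length-mirror D) len)

  edge-arc : ∀ {x y} → ShiftEdge n P m is js a x y → ShiftArc (x , y)
  edge-arc (inj₁ (black , not-c)) = old black λ {t} _ xy≡ct → not-c (clamp m t , cong proj₁ xy≡ct , cong proj₂ xy≡ct)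
  edge-arc (inj₂ (inj₁ (refl , refl))) = new (s≤s z≤n)
  edge-arc (inj₂ (inj₂ (inj₁ (r , refl , refl)))) =
    subst ShiftArc (cong₂ _,_ (cong is (clamp-toℕ m (suc r)))
                              (cong js (trans (cong (clamp m) (sym (Finₚ.toℕ-inject₁ r))) (clamp-toℕ m (inject₁ r)))))
      (new (s≤s (Finₚ.toℕ<n r)))
  edge-arc (inj₂ (inj₂ (inj₂ (refl , refl)))) =
    subst (λ q → ShiftArc (a , js q)) (trans (cong (clamp m) (sym (Finₚ.toℕ-fromℕ m))) (clamp-toℕ m (fromℕ m))) last

  R-injective : ∀ {t u} → t < K → u < K → R t ≡ R u → t ≡ u
  R-injective {zero} {zero} _ _ _ = refl
  R-injective {zero} {suc u} _ u+1<K a≡Ju = ⊥-elim (ℕₚ.<-irrefl a≡Ju (a<J (ℕₚ.<-trans (ℕₚ.n<1+n u) u+1<K)))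
  R-injective {suc t} {zero} t+1<K _ Jt≡a = ⊥-elim (ℕₚ.<-irrefl (sym Jt≡a) (a<J (ℕₚ.<-trans (ℕₚ.n<1+n t) t+1<K)))
  R-injective {suc t} {suc u} t+1<K u+1<K Jt≡Ju =
    cong suc (increasing-injective J-mono (ℕₚ.<-trans (ℕₚ.n<1+n t) t+1<K) (ℕₚ.<-trans (ℕₚ.n<1+n u) u+1<K) Jt≡Ju)

  R<Jm : ∀ {t} → t < K → R t < J m
  R<Jm t<K = ℕₚ.<-≤-trans (R≺J t<K) (J-mono-≤ (ℕₚ.≤-pred t<K) (ℕₚ.n<1+n m))

  old-left-unique : ∀ {e f} → Black e → (∀ {t} → t < K → e ≢ c t) → ShiftArc f → X e ≡ X f → e ≡ f
  old-left-unique be _ (old bf _) Xe≡Xf = black-left-unique be bf Xe≡Xf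
  old-left-unique be not-c (new t<K) Xe≡It = ⊥-elim (not-c t<K (black-left-unique be (c-black t<K) Xe≡It))
  old-left-unique be _ last refl = ⊥-elim (black-left-not-red be a-red)

  shift-left-unique : ∀ {e f} → ShiftArc e → ShiftArc f → X e ≡ X f → e ≡ f
  shift-left-unique (old be not-c) sf Xe≡Xf = old-left-unique be not-c sf Xe≡Xf
  shift-left-unique se (old bf not-c) Xe≡Xf = sym (old-left-unique bf not-c se (sym Xe≡Xf))
  shift-left-unique (new t<K) (new u<K) It≡Iu = cong (λ s → I s , R s) (increasing-injective I-mono t<K u<K It≡Iu)
  shift-left-unique (new t<K) last It≡a = ⊥-elim (ℕₚ.<-irrefl It≡a (I<a t<K))
  shift-left-unique last (new t<K) a≡It = ⊥-elim (ℕₚ.<-irrefl (sym a≡It) (I<a t<K))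
  shift-left-unique last last _ = refl

  old-right-unique : ∀ {e f} → Black e → (∀ {t} → t < K → e ≢ c t) → ShiftArc f → Y e ≡ Y f → e ≡ f
  old-right-unique be _ (old bf _) Ye≡Yf = black-right-unique be bf Ye≡Yf
  old-right-unique be _ (new {zero} _) refl = ⊥-elim (black-right-not-red be a-red)
  old-right-unique be not-c (new {suc t} t+1<K) Ye≡Jt =
    ⊥-elim (not-c t<K (black-right-unique be (c-black t<K) Ye≡Jt))
    where t<K = ℕₚ.<-trans (ℕₚ.n<1+n t) t+1<K
  old-right-unique be not-c last Ye≡Jm = ⊥-elim (not-c (ℕₚ.n<1+n m) (black-right-unique be (c-black (ℕₚ.n<1+n m)) Ye≡Jm))

  shift-right-unique : ∀ {e f} → ShiftArc e → ShiftArc f → Y e ≡ Y f → e ≡ f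
  shift-right-unique (old be not-c) sf Ye≡Yf = old-right-unique be not-c sf Ye≡Yf
  shift-right-unique se (old bf not-c) Ye≡Yf = sym (old-right-unique bf not-c se (sym Ye≡Yf))
  shift-right-unique (new t<K) (new u<K) Rt≡Ru = cong (λ s → I s , R s) (R-injective t<K u<K Rt≡Ru)
  shift-right-unique (new t<K) last Rt≡Jm = ⊥-elim (ℕₚ.<-irrefl Rt≡Jm (R<Jm t<K))
  shift-right-unique last (new t<K) Jm≡Rt = ⊥-elim (ℕₚ.<-irrefl (sym Jm≡Rt) (R<Jm t<K))
  shift-right-unique last last _ = refl

  shift-right-end : ∀ {e} → ShiftArc e → Y e ≤ n × (¬ Red n P (Y e) ⊎ Y e ≡ a)
  shift-right-end (old be _) = black-right-end be
    where
    black-right-end : ∀ {e} → Black e → Y e ≤ n × (¬ Red n P (Y e) ⊎ Y e ≡ a)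
    black-right-end be = proj₁ (proj₂ (proj₁ be)) , inj₁ (black-right-not-red be)
  shift-right-end (new {zero} _) = proj₁ a-red , inj₂ refl
  shift-right-end (new {suc t} t+1<K) = proj₁ (proj₂ (proj₁ bc)) , inj₁ (black-right-not-red bc)
    where bc = c-black (ℕₚ.<-trans (ℕₚ.n<1+n t) t+1<K)
  shift-right-end last = proj₁ (proj₂ (proj₁ bc)) , inj₁ (black-right-not-red bc)
    where bc = c-black (ℕₚ.n<1+n m)

  -- Q-blocks of black elements are components of the shift graph, whose
  -- components are increasing paths; hence every black arc of Q is a shift arc.
  module OfShift (Q : Partition) (shift : IsEnhancedLeftShift n P m is js a Q) where

    open IncreasingPaths (ShiftEdge n P m is js a) (λ e → shift-increasing (edge-arc e))
      (λ e e′ → cong Y (shift-left-unique (edge-arc e) (edge-arc e′) refl))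
      (λ e e′ → cong X (shift-right-unique (edge-arc e) (edge-arc e′) refl))

    black-or-a : ∀ {x} → x ≤ n → Q x ≢ Q 0 → ¬ Red n P x ⊎ x ≡ a
    black-or-a {x} x≤n not-red with x ℕₚ.≟ a
    ... | yes x≡a = inj₂ x≡a
    ... | no x≢a = inj₁ λ x-red → not-red (Equivalence.from (proj₁ shift x x≤n) (x-red , x≢a))

    q-arc-shift : ∀ {x y} → BlackArc n Q x y → ShiftArc (x , y)
    q-arc-shift {x} {y} ((x<y , y≤n , Qx≡Qy , gap) , not-red) = edge-arc (single-edge path x<y no-stop)
      where
      x≤n : x ≤ n
      x≤n = ℕₚ.<⇒≤ (ℕₚ.<-≤-trans x<y y≤n)
      x-not-red : Q x ≢ Q 0
      x-not-red Qx≡Q0 = not-red ((x≤n , Qx≡Q0) , (y≤n , trans (sym Qx≡Qy) Qx≡Q0))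
      x-black = black-or-a x≤n x-not-red
      y-black = black-or-a y≤n (x-not-red ∘ trans Qx≡Qy)
      path : Star (ShiftEdge n P m is js a) x y
      path with directed (Equivalence.to (proj₂ shift x y x≤n y≤n x-black y-black) Qx≡Qy)
      ... | inj₁ p = p
      ... | inj₂ p = ⊥-elim (ℕₚ.<⇒≱ x<y (path-≤ p))
      no-stop : ∀ {z} → x < z → z < y → ¬ ShiftEdge n P m is js a x z
      no-stop {z} x<z z<y e = gap z x<z z<y (sym (Equivalence.from
        (proj₂ shift x z x≤n (ℕₚ.<⇒≤ (ℕₚ.<-≤-trans z<y y≤n)) x-black (proj₂ (shift-right-end (edge-arc e))))
        (fwd e ◅ ε)))

lemma3p2 : (m n : ℕ) (P : Partition)
    → NoBlackCrossing n P (suc (suc m))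
    → (a : ℕ) → RedUnder n P (suc m) a
    → (∀ b → b < a → ¬ RedUnder n P (suc m) b)
    → (is js : Fin (suc m) → ℕ)
    → BlackCrossing n P (suc m) is js → Under (suc m) is js a
    → (∀ is′ js′ → BlackCrossing n P (suc m) is′ js′ → Under (suc m) is′ js′ a
         → ¬ LexLt (suc m) js′ js)
    → (Q : Partition) → IsEnhancedLeftShift n P m is js a Q
    → NoBlackCrossing n Q (suc (suc m))
lemma3p2 m n P no-k-crossing a (a-red , _) _ is js crossing under lex-least Q shift
         is′ js′ ((left-mono , right-mono , left<right) , q-black) =
  no-shift-crossing (tabulate arc)
    (AllPairsₚ.tabulate⁺-< λ {r} {s} r<s → left-mono r s r<s , right-mono r s r<s , left<right s r)
    (Allₚ.tabulate⁺ λ r → q-arc-shift (q-black r))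
    (length-tabulate arc)
  where
  open Setting m n P no-k-crossing a a-red is js crossing under lex-least
  open OfShift Q shift
  arc : Fin (suc (suc m)) → ℕ × ℕ
  arc r = is′ r , js′ r
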